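{- Let $\mathcal{C}$ be any $f$-separable hereditary class and let $G\in\mathcal{C}$ have $n$ vertices. Then the number of nodes in the binary separation tree $\mathcal{T}_{\mathsf{sep}}$ of $G$ is $O\big(\frac{n}{f(n)}\big)$.
   Context: A set $S\subset V$ is an $(s,\alpha)$-separator of $G=(V,E)$ if $V=A\cup B\cup S$ with $A,B,S$ pairwise disjoint, $|S|\le s$, $|A|,|B|\le\alpha|V|$ and no edge joins $A$ and $B$. The separation number $\mathrm{s}(G)$ is the least $s$ such that every subgraph of $G$ has an $(s,2/3)$-separator. For $f:\mathbb{N}\to\mathbb{N}$, a class $\mathcal{C}$ is $f$-separable if every $n$-vertex $G\in\mathcal{C}$ satisfies $\mathrm{s}(G)\le f(n)$; hereditary means closed under induced subgraphs. The binary separation tree $\mathcal{T}_{\mathsf{sep}}$ of $G$ is taken with respect to a separation algorithm $\mathcal{S}$ that on an induced subgraph $H$ of $G$ with $m$ vertices returns a partition $(A,B,C)$ of $V(H)$ with $C$ an $(f(m),2/3)$-separator and separated sets $A,B$, and with threshold $f(n)$: the root is $V(G)$; a node $\omega\subseteq V(G)$ with $|\omega|>f(n)$ has as children the two separated sets $A,B$ obtained by applying $\mathcal{S}$ to $G[\omega]$; a node with $|\omega|\le f(n)$ is a leaf. -}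

module Defs where

open import Level using (0ℓ)
open import Data.Nat using (ℕ; suc; _+_; _*_; _≤_; _<_)
open import Data.Fin using (Fin)
open import Data.Fin.Subset using (Subset; _∪_; _∩_; _⊆_; _∈_; ∣_∣; ⊤; ⊥)
open import Data.Product using (Σ; _×_; _,_; ∃)
open import Relation.Nullary using (¬_)
open import Relation.Binary.PropositionalEquality using (_≡_)
open import Function.Definitions using (Injective)

record Graph (n : ℕ) : Set₁ where
  field
    Adj    : Fin n → Fin n → Set
    sym    : ∀ {u v} → Adj u v → Adj v u
    irrefl : ∀ {u} → ¬ Adj u u
open Graph public

IsSepPartition : ∀ {n} → Graph n → Subset n → ℕ →
                 Subset n → Subset n → Subset n → Set
IsSepPartition G ω s A B S =
  (A ∪ B ∪ S ≡ ω) ×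
  (A ∩ B ≡ ⊥) × (A ∩ S ≡ ⊥) × (B ∩ S ≡ ⊥) ×
  (∣ S ∣ ≤ s) ×
  (3 * ∣ A ∣ ≤ 2 * ∣ ω ∣) × (3 * ∣ B ∣ ≤ 2 * ∣ ω ∣) ×
  (∀ u v → u ∈ A → v ∈ B → ¬ Adj G u v)

IsSeparator : ∀ {n} → Graph n → ℕ → Subset n → Set
IsSeparator G s S = Σ _ λ A → Σ _ λ B → IsSepPartition G ⊤ s A B S

HasSeparator : ∀ {n} → Graph n → ℕ → Set
HasSeparator G s = Σ _ λ S → IsSeparator G s S

record Subgraph {n : ℕ} (G : Graph n) : Set₁ where
  field
    k      : ℕ
    emb    : Fin k → Fin n
    emb-inj : Injective _≡_ _≡_ emb
    graph  : Graph k
    edges⊆ : ∀ {u v} → Adj graph u v → Adj G (emb u) (emb v)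
open Subgraph public

AllSubgraphsSeparable : ∀ {n} → Graph n → ℕ → Set₁
AllSubgraphsSeparable G s = ∀ (H : Subgraph G) → HasSeparator (graph H) s

IsSepNumber : ∀ {n} → Graph n → ℕ → Set₁
IsSepNumber G s = AllSubgraphsSeparable G s × (∀ s' → s' < s → ¬ AllSubgraphsSeparable G s')

SepNumber≤ : ∀ {n} → Graph n → ℕ → Set₁
SepNumber≤ G t = Σ ℕ λ s → IsSepNumber G s × s ≤ t

GraphClass : Set₂
GraphClass = ∀ {n} → Graph n → Set₁

induced : ∀ {n k} → Graph n → (ι : Fin k → Fin n) → Injective _≡_ _≡_ ι → Graph k
induced G ι inj = record
  { Adj = λ u v → Adj G (ι u) (ι v)
  ; sym = sym G
  ; irrefl = irrefl G }

Hereditary : GraphClass → Set₁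
Hereditary 𝒞 = ∀ {n k} (G : Graph n) (ι : Fin k → Fin n) (inj : Injective _≡_ _≡_ ι) →
               𝒞 G → 𝒞 (induced G ι inj)

Separable : (ℕ → ℕ) → GraphClass → Set₁
Separable f 𝒞 = ∀ {n} (G : Graph n) → 𝒞 G → SepNumber≤ G (f n)

-- A separation algorithm for G w.r.t. f: applied to the induced subgraph G[ω]
-- (ω ⊆ V(G), m = |ω|) it returns a partition (A, B, C) of ω where C is an
-- (f(m), 2/3)-separator of G[ω] with separated sets A, B.
SepAlgorithm : ℕ → Set
SepAlgorithm n = Subset n → Subset n × Subset n × Subset n

IsSepAlgorithm : ∀ {n} → Graph n → (ℕ → ℕ) → SepAlgorithm n → Set
IsSepAlgorithm G f 𝒮 = ∀ ω → let (A , B , C) = 𝒮 ω in IsSepPartition G ω (f ∣ ω ∣) A B C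

-- NodeCount G f 𝒮 ω N : the binary separation tree rooted at ω (threshold f n,
-- where n = |V(G)|) has exactly N nodes.
data NodeCount {n : ℕ} (G : Graph n) (f : ℕ → ℕ) (𝒮 : SepAlgorithm n) :
               Subset n → ℕ → Set where
  leaf : ∀ {ω} → ∣ ω ∣ ≤ f n → NodeCount G f 𝒮 ω 1
  node : ∀ {ω A B C a b} → f n < ∣ ω ∣ → 𝒮 ω ≡ (A , B , C) →
         NodeCount G f 𝒮 A a → NodeCount G f 𝒮 B b →
         NodeCount G f 𝒮 ω (suc (a + b))

SepTreeSize : ∀ {n} → Graph n → (ℕ → ℕ) → SepAlgorithm n → ℕ → Set
SepTreeSize G f 𝒮 N = NodeCount G f 𝒮 ⊤ N

{-# OPTIONS --safe #-}
-- Write t = f(n). Every internal node ω of the tree has t < |ω|, and its children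
-- A, B satisfy |A| + |B| ≤ |ω| and |A|, |B| ≤ 2|ω|/3. By induction, a subtree with
-- N nodes rooted at an internal node ω satisfies (N + 1) t ≤ 4 |ω|: two internal
-- children just add their bounds, two leaf children cost 4t < 4|ω|, and a leaf
-- child's share 2t is paid for by its internal sibling B, because t < |B| and
-- 6 |B| ≤ 4 |ω|. At the root this gives N t ≤ 4 (n + t).
module Submission where

open import Defs hiding (sym)
open import Data.Nat using (ℕ; suc; _+_; _*_; _≤_; _<_)
open import Data.Nat.Properties
open import Data.Product using (Σ; _×_; _,_)
open import Data.Sum using (_⊎_; inj₁; inj₂)
open import Data.Bool using (true; false)
open import Data.Vec using ([]; _∷_)
open import Data.Fin.Subset using (Subset; _∪_; _∩_; ∣_∣; ⊤; ⊥)
open import Data.Fin.Subset.Properties using (∣⊥∣≡0; ∣⊤∣≡n; ∣p∣≤∣p∪q∣; ∪-assoc)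
open import Relation.Binary.PropositionalEquality

∣p∣+∣q∣≡∣p∪q∣+∣p∩q∣ : ∀ {n} (p q : Subset n) → ∣ p ∣ + ∣ q ∣ ≡ ∣ p ∪ q ∣ + ∣ p ∩ q ∣
∣p∣+∣q∣≡∣p∪q∣+∣p∩q∣ []          []          = refl
∣p∣+∣q∣≡∣p∪q∣+∣p∩q∣ (false ∷ p) (false ∷ q) = ∣p∣+∣q∣≡∣p∪q∣+∣p∩q∣ p q
∣p∣+∣q∣≡∣p∪q∣+∣p∩q∣ (false ∷ p) (true ∷ q)  =
  trans (+-suc ∣ p ∣ ∣ q ∣) (cong suc (∣p∣+∣q∣≡∣p∪q∣+∣p∩q∣ p q))
∣p∣+∣q∣≡∣p∪q∣+∣p∩q∣ (true ∷ p)  (false ∷ q) = cong suc (∣p∣+∣q∣≡∣p∪q∣+∣p∩q∣ p q)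
∣p∣+∣q∣≡∣p∪q∣+∣p∩q∣ (true ∷ p)  (true ∷ q)  = cong suc (begin
  ∣ p ∣ + suc ∣ q ∣                 ≡⟨ +-suc ∣ p ∣ ∣ q ∣ ⟩
  suc (∣ p ∣ + ∣ q ∣)               ≡⟨ cong suc (∣p∣+∣q∣≡∣p∪q∣+∣p∩q∣ p q) ⟩
  suc (∣ p ∪ q ∣ + ∣ p ∩ q ∣)       ≡⟨ +-suc ∣ p ∪ q ∣ ∣ p ∩ q ∣ ⟨
  ∣ p ∪ q ∣ + suc ∣ p ∩ q ∣         ∎)
  where open ≡-Reasoning

disjoint⇒∣p∪q∣≡∣p∣+∣q∣ : ∀ {n} (p q : Subset n) → p ∩ q ≡ ⊥ → ∣ p ∪ q ∣ ≡ ∣ p ∣ + ∣ q ∣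
disjoint⇒∣p∪q∣≡∣p∣+∣q∣ {n} p q p∩q≡⊥ = sym (begin
  ∣ p ∣ + ∣ q ∣               ≡⟨ ∣p∣+∣q∣≡∣p∪q∣+∣p∩q∣ p q ⟩
  ∣ p ∪ q ∣ + ∣ p ∩ q ∣       ≡⟨ cong (λ r → ∣ p ∪ q ∣ + ∣ r ∣) p∩q≡⊥ ⟩
  ∣ p ∪ q ∣ + ∣ ⊥ {n} ∣       ≡⟨ cong (∣ p ∪ q ∣ +_) (∣⊥∣≡0 n) ⟩
  ∣ p ∪ q ∣ + 0               ≡⟨ +-identityʳ ∣ p ∪ q ∣ ⟩
  ∣ p ∪ q ∣                   ∎)
  where open ≡-Reasoning

separated-sets-fit : ∀ {n} {G : Graph n} {ω A B C : Subset n} {s : ℕ} →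
                     IsSepPartition G ω s A B C → ∣ A ∣ + ∣ B ∣ ≤ ∣ ω ∣
separated-sets-fit {A = A} {B} {C} (A∪B∪C≡ω , A∩B≡⊥ , _) = begin
  ∣ A ∣ + ∣ B ∣      ≡⟨ disjoint⇒∣p∪q∣≡∣p∣+∣q∣ A B A∩B≡⊥ ⟨
  ∣ A ∪ B ∣          ≤⟨ ∣p∣≤∣p∪q∣ (A ∪ B) C ⟩
  ∣ (A ∪ B) ∪ C ∣    ≡⟨ cong ∣_∣ (trans (∪-assoc A B C) A∪B∪C≡ω) ⟩
  _                  ∎
  where open ≤-Reasoning

TreeBound : (t x N : ℕ) → Set
TreeBound t x N = N ≡ 1 ⊎ (t < x × suc N * t ≤ 4 * x)

module _ {t x : ℕ} where
  open ≤-Reasoning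

  leaf-beside-internal : ∀ {β b} → t < β → 3 * β ≤ 2 * x → suc b * t ≤ 4 * β →
                         (3 + b) * t ≤ 4 * x
  leaf-beside-internal {β} {b} t<β 3β≤2x hb = begin
    (2 + suc b) * t        ≡⟨ *-distribʳ-+ t 2 (suc b) ⟩
    2 * t + suc b * t      ≤⟨ +-mono-≤ (*-monoʳ-≤ 2 (<⇒≤ t<β)) hb ⟩
    2 * β + 4 * β          ≡⟨ *-distribʳ-+ β 2 4 ⟨
    6 * β                  ≡⟨ *-assoc 2 3 β ⟩
    2 * (3 * β)            ≤⟨ *-monoʳ-≤ 2 3β≤2x ⟩
    2 * (2 * x)            ≡⟨ *-assoc 2 2 x ⟨
    4 * x                  ∎

  two-internal : ∀ {α β a b} → α + β ≤ x → suc a * t ≤ 4 * α → suc b * t ≤ 4 * β →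
                 suc (suc (a + b)) * t ≤ 4 * x
  two-internal {α} {β} {a} {b} α+β≤x ha hb = begin
    suc (suc (a + b)) * t  ≡⟨ cong (_* t) (+-suc (suc a) b) ⟨
    (suc a + suc b) * t    ≡⟨ *-distribʳ-+ t (suc a) (suc b) ⟩
    suc a * t + suc b * t  ≤⟨ +-mono-≤ ha hb ⟩
    4 * α + 4 * β          ≡⟨ *-distribˡ-+ 4 α β ⟨
    4 * (α + β)            ≤⟨ *-monoʳ-≤ 4 α+β≤x ⟩
    4 * x                  ∎

  TreeBound-node : ∀ {α β a b} → t < x → α + β ≤ x → 3 * α ≤ 2 * x → 3 * β ≤ 2 * x →
                   TreeBound t α a → TreeBound t β b → TreeBound t x (suc (a + b))
  TreeBound-node t<x _ _ _ (inj₁ refl) (inj₁ refl) =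
    inj₂ (t<x , *-monoʳ-≤ 4 (<⇒≤ t<x))
  TreeBound-node {β = β} {b = b} t<x _ _ 3β≤2x (inj₁ refl) (inj₂ (t<β , hb)) =
    inj₂ (t<x , leaf-beside-internal {β} {b} t<β 3β≤2x hb)
  TreeBound-node {α = α} {a = a} t<x _ 3α≤2x _ (inj₂ (t<α , ha)) (inj₁ refl) =
    inj₂ (t<x , subst (λ k → suc (suc k) * t ≤ 4 * x) (+-comm 1 a)
                      (leaf-beside-internal {α} {a} t<α 3α≤2x ha))
  TreeBound-node {α} {β} {a} {b} t<x α+β≤x _ _ (inj₂ (_ , ha)) (inj₂ (_ , hb)) =
    inj₂ (t<x , two-internal {α} {β} {a} {b} α+β≤x ha hb)

  TreeBound⇒N*t≤4[x+t] : ∀ {N} → TreeBound t x N → N * t ≤ 4 * (x + t)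
  TreeBound⇒N*t≤4[x+t] (inj₁ refl) = begin
    1 * t          ≡⟨ *-identityˡ t ⟩
    t              ≤⟨ m≤n+m t x ⟩
    x + t          ≤⟨ m≤n*m (x + t) 4 ⟩
    4 * (x + t)    ∎
  TreeBound⇒N*t≤4[x+t] {N} (inj₂ (_ , h)) = begin
    N * t          ≤⟨ m≤n+m (N * t) t ⟩
    suc N * t      ≤⟨ h ⟩
    4 * x          ≤⟨ *-monoʳ-≤ 4 (m≤m+n x t) ⟩
    4 * (x + t)    ∎

module _ {n : ℕ} (G : Graph n) (f : ℕ → ℕ) (𝒮 : SepAlgorithm n)
         (𝒮-correct : IsSepAlgorithm G f 𝒮) where

  partition-of : ∀ {ω A B C} → 𝒮 ω ≡ (A , B , C) → IsSepPartition G ω (f ∣ ω ∣) A B C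
  partition-of {ω} 𝒮ω≡ABC =
    subst (λ { (A , B , C) → IsSepPartition G ω (f ∣ ω ∣) A B C }) 𝒮ω≡ABC (𝒮-correct ω)

  NodeCount⇒TreeBound : ∀ {ω N} → NodeCount G f 𝒮 ω N → TreeBound (f n) ∣ ω ∣ N
  NodeCount⇒TreeBound (leaf _) = inj₁ refl
  NodeCount⇒TreeBound (node t<ω 𝒮ω≡ABC tree-A tree-B)
    with partition-of 𝒮ω≡ABC
  ... | P@(_ , _ , _ , _ , _ , 3A≤2ω , 3B≤2ω , _) =
    TreeBound-node t<ω (separated-sets-fit {G = G} P) 3A≤2ω 3B≤2ω
                   (NodeCount⇒TreeBound tree-A) (NodeCount⇒TreeBound tree-B)

corollary1 : Σ ℕ λ c →
    ∀ (𝒞 : GraphClass) (f : ℕ → ℕ) → Hereditary 𝒞 → Separable f 𝒞 →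
    ∀ {n} (G : Graph n) → 𝒞 G →
    ∀ (𝒮 : SepAlgorithm n) → IsSepAlgorithm G f 𝒮 →
    ∀ N → SepTreeSize G f 𝒮 N → N * f n ≤ c * (n + f n)
corollary1 = 4 , λ _ f _ _ {n} G _ 𝒮 𝒮-correct N tree →
  subst (λ m → N * f n ≤ 4 * (m + f n)) (∣⊤∣≡n n)
        (TreeBound⇒N*t≤4[x+t] (NodeCount⇒TreeBound G f 𝒮 𝒮-correct tree))
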